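{- Let $p\ge 1$ be an integer, $G$ a graph with at least two vertices, and $H$ a graph. Then $(G\circ H)^{[\natural p]}$ is connected if and only if $G^{[\natural p]}$ is connected.
   Context: For a graph $G$ and a positive integer $p$, $G^{[\natural p]}$ is the graph on $V(G)$ in which two vertices are adjacent iff their distance in $G$ is exactly $p$ (so $G^{[\natural 1]}=G$). The lexicographic product $G\circ H$ has vertex set $V(G)\times V(H)$, with $(g_1,h_1)(g_2,h_2)$ an edge iff either $g_1g_2\in E(G)$, or $g_1=g_2$ and $h_1h_2\in E(H)$. -}

module Defs where

open import Data.Nat using (ℕ; zero; suc; _<_)
open import Data.Fin using (Fin)
open import Data.Product using (_×_; _,_; ∃-syntax)
open import Data.Sum using (_⊎_; inj₁; inj₂)
open import Relation.Nullary using (¬_; Dec)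
open import Relation.Binary.PropositionalEquality using (_≡_)

record Graph (n : ℕ) : Set₁ where
  field
    Adj    : Fin n → Fin n → Set
    adj?   : ∀ u v → Dec (Adj u v)
    adj-sym : ∀ {u v} → Adj u v → Adj v u
    irrefl  : ∀ {u} → ¬ Adj u u
open Graph public

data Walk {V : Set} (R : V → V → Set) : V → V → ℕ → Set where
  here : ∀ {u} → Walk R u u zero
  step : ∀ {u w v k} → R u w → Walk R w v k → Walk R u v (suc k)

Connected : {V : Set} → (V → V → Set) → Set
Connected {V} R = ∀ (u v : V) → ∃[ k ] Walk R u v k

Dist : {V : Set} → (V → V → Set) → V → V → ℕ → Set
Dist R u v d = Walk R u v d × (∀ k → k < d → ¬ Walk R u v k)

ExactDist : {V : Set} → (V → V → Set) → ℕ → V → V → Set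
ExactDist R p u v = Dist R u v p

LexAdj : ∀ {n m} → Graph n → Graph m → Fin n × Fin m → Fin n × Fin m → Set
LexAdj G H (g₁ , h₁) (g₂ , h₂) = Adj G g₁ g₂ ⊎ (g₁ ≡ g₂ × Adj H h₁ h₂)

-- Away from the diagonal of G, distances in G ∘ H are those of G: a walk in
-- G ∘ H projects to a walk in G that is no longer (steps inside an H-fibre
-- disappear), and a walk of positive length in G lifts to G ∘ H with arbitrary
-- H-coordinates at its ends.  Hence (G ∘ H)^[♮p] projects onto G^[♮p] (edges
-- inside a fibre are dropped), which gives one direction.  Conversely, when
-- G^[♮p] is connected and G has two vertices, any two vertices of G are joined
-- by a walk of positive length in G^[♮p], and such a walk lifts.
module Submission where

open import Defs
open import Data.Nat using (ℕ; zero; suc; _≤_; _<_; z≤n; s≤s)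
open import Data.Nat.Properties using (≤-antisym; ≮⇒≥; <-≤-trans; m≤n⇒m≤1+n)
open import Data.Fin using (Fin; punchIn) renaming (zero to fzero)
open import Data.Fin.Properties using (punchInᵢ≢i) renaming (_≟_ to _≟ᶠ_)
open import Data.Product using (_×_; _,_; proj₁; ∃-syntax)
open import Data.Sum using (_⊎_; inj₁; inj₂)
open import Function.Bundles using (_⇔_; mk⇔)
open import Relation.Nullary using (¬_; yes; no; contradiction)
open import Relation.Binary.PropositionalEquality
  using (_≡_; _≢_; refl; sym; subst; ≢-sym)

Walk-zero⇒≡ : ∀ {V : Set} {R : V → V → Set} {u v} → Walk R u v zero → u ≡ v
Walk-zero⇒≡ here = refl

Walk-contract : ∀ {V W : Set} {S : V → V → Set} {R : W → W → Set} (π : V → W)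
  → (∀ {x y} → S x y → R (π x) (π y) ⊎ π x ≡ π y)
  → ∀ {x y k} → Walk S x y k → ∃[ j ] j ≤ k × Walk R (π x) (π y) j
Walk-contract π f here = zero , z≤n , here
Walk-contract {R = R} π f {y = y} (step e w) with f e | Walk-contract π f w
... | inj₁ e′  | j , j≤k , w′ = suc j , s≤s j≤k , step e′ w′
... | inj₂ π≡π | j , j≤k , w′ =
  j , m≤n⇒m≤1+n j≤k , subst (λ z → Walk R z (π y) j) (sym π≡π) w′

Walk⁺-lift : ∀ {A B : Set} {R : A → A → Set} {S : A × B → A × B → Set}
  → (∀ {a b x y} → R a b → S (a , x) (b , y))
  → ∀ {a b k} → Walk R a b (suc k) → ∀ x y → Walk S (a , x) (b , y) (suc k)
Walk⁺-lift f (step e here)          x y = step (f e) here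
Walk⁺-lift f (step e w@(step _ _)) x y = step (f e) (Walk⁺-lift f w y y)

Connected⇒Walk⁺ : ∀ {V : Set} {R : V → V → Set} → Connected R
  → (∀ u → ∃[ v ] u ≢ v) → ∀ u t → ∃[ k ] Walk R u t (suc k)
Connected⇒Walk⁺ conn other u t with other u
... | v , u≢v with conn u v
...   | zero  , w = contradiction (Walk-zero⇒≡ w) u≢v
...   | suc _ , step {w = w} e _ with conn w t
...     | k , w⇝t = k , step e w⇝t

Fin-other : ∀ {n} → 2 ≤ n → (u : Fin n) → ∃[ v ] u ≢ v
Fin-other (s≤s (s≤s _)) u = punchIn u fzero , ≢-sym (punchInᵢ≢i u fzero)

module Lex {n m : ℕ} (G : Graph n) (H : Graph m) where

  L : Fin n × Fin m → Fin n × Fin m → Set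
  L = LexAdj G H

  Walk-project : ∀ {x y k} → Walk L x y k
    → ∃[ j ] j ≤ k × Walk (Adj G) (proj₁ x) (proj₁ y) j
  Walk-project = Walk-contract proj₁ λ where
    (inj₁ e)        → inj₁ e
    (inj₂ (eq , _)) → inj₂ eq

  Walk⁺-lift-G : ∀ {a b k} → Walk (Adj G) a b (suc k)
    → ∀ x y → Walk L (a , x) (b , y) (suc k)
  Walk⁺-lift-G = Walk⁺-lift inj₁

  ExactDist-lift : ∀ {p a b} → 1 ≤ p → ExactDist (Adj G) p a b
    → ∀ x y → ExactDist L p (a , x) (b , y)
  ExactDist-lift {suc _} _ (w , no-shorter) x y =
    Walk⁺-lift-G w x y , λ k k<p w′ →
      let (j , j≤k , wG) = Walk-project w′
      in no-shorter j (<-≤-trans (s≤s j≤k) k<p) wG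

  ExactDist-project : ∀ {p a b x y} → a ≢ b
    → ExactDist L p (a , x) (b , y) → ExactDist (Adj G) p a b
  ExactDist-project {p} {a} {b} {x} {y} a≢b (w , no-shorter)
    with Walk-project w
  ... | j , j≤p , wG =
    subst (Walk (Adj G) a b) (≤-antisym j≤p (≮⇒≥ λ j<p → no-shorterᴳ j j<p wG))
      wG , no-shorterᴳ
    where
    no-shorterᴳ : ∀ k → k < p → ¬ Walk (Adj G) a b k
    no-shorterᴳ zero    _   wG′ = a≢b (Walk-zero⇒≡ wG′)
    no-shorterᴳ (suc k) k<p wG′ = no-shorter (suc k) k<p (Walk⁺-lift-G wG′ x y)

  ExactDist-project⊎≡ : ∀ {p x y} → ExactDist L p x y
    → ExactDist (Adj G) p (proj₁ x) (proj₁ y) ⊎ proj₁ x ≡ proj₁ y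
  ExactDist-project⊎≡ {x = a , _} {y = b , _} d with a ≟ᶠ b
  ... | yes a≡b = inj₂ a≡b
  ... | no  a≢b = inj₁ (ExactDist-project a≢b d)

proposition3p3 : (p n m : ℕ) → 1 ≤ p → 2 ≤ n → 1 ≤ m
    → (G : Graph n) → (H : Graph m)
    → Connected (ExactDist (LexAdj G H) p) ⇔ Connected (ExactDist (Adj G) p)
proposition3p3 p n (suc _) 1≤p 2≤n _ G H = mk⇔ project lift
  where
  open Lex G H

  project : Connected (ExactDist L p) → Connected (ExactDist (Adj G) p)
  project conn g₁ g₂ =
    let (_ , w) = conn (g₁ , fzero) (g₂ , fzero)
        (j , _ , w′) = Walk-contract proj₁ ExactDist-project⊎≡ w
    in j , w′

  lift : Connected (ExactDist (Adj G) p) → Connected (ExactDist L p)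
  lift conn (g₁ , h₁) (g₂ , h₂) =
    let (k , w) = Connected⇒Walk⁺ conn (Fin-other 2≤n) g₁ g₂
    in suc k , Walk⁺-lift (λ d → ExactDist-lift 1≤p d _ _) w h₁ h₂
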